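{- Let $\Lambda=T_1\sqcup\cdots\sqcup T_m$ be a partition of $\Lambda$ into pairwise disjoint tilings $T_1,\dots,T_m$. For $S\subseteq[m]$ put $T_S=\bigcup_{s\in S}T_s$. Then $T_S$ is a tiling for every $S\subseteq[m]$.
   Context: Fix an integer $n\ge 2$, $[n]=\{1,\dots,n\}$, and let $\Lambda$ be the set of triples $ijk$ with $i<j<k$ in $[n]$. For a quadruple $i<j<k<l$, its stick is the ordered sequence $(ijk,ijl,ikl,jkl)$. A subset of $\Lambda$ is a pseudo-tiling; it is a tiling if for every quadruple $i<j<k<l$ its intersection with the stick, written as a 0/1 string along the stick order, is one of $0000,1000,1100,1110,1111,0111,0011,0001$ (these are the inversion sets of rhombus tilings of the zonogon $Z(n;2)$). -}

module Defs where

open import Data.Nat using (ℕ; zero; suc)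
open import Data.Fin using (Fin; _<_; zero; suc)
open import Data.Fin.Properties using (<-trans)
open import Data.Vec using (lookup)
open import Data.Bool using (Bool; true; false; _∨_; _∧_)
open import Data.Product using (Σ; _×_; _,_; ∃)
open import Data.Sum using (_⊎_)
open import Data.List using (List; []; _∷_; allFin)
open import Data.Bool.ListAction using (any)
open import Data.List.Membership.Propositional using (_∈_)
open import Data.Fin.Subset using (Subset)
open import Data.Vec using (Vec; []; _∷_)
open import Relation.Binary.PropositionalEquality using (_≡_)

-- Λ: triples ijk with i < j < k in [n], [n] modelled by Fin n (order via Fin's _<_)
record Triple (n : ℕ) : Set where
  constructor triple
  field
    i j k : Fin n
    i<j : i < j
    j<k : j < k

PseudoTiling : ℕ → Set
PseudoTiling n = Triple n → Bool

Word4 : Set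
Word4 = Vec Bool 4

allowed : List Word4
allowed =
  (false ∷ false ∷ false ∷ false ∷ []) ∷
  (true  ∷ false ∷ false ∷ false ∷ []) ∷
  (true  ∷ true  ∷ false ∷ false ∷ []) ∷
  (true  ∷ true  ∷ true  ∷ false ∷ []) ∷
  (true  ∷ true  ∷ true  ∷ true  ∷ []) ∷
  (false ∷ true  ∷ true  ∷ true  ∷ []) ∷
  (false ∷ false ∷ true  ∷ true  ∷ []) ∷
  (false ∷ false ∷ false ∷ true  ∷ []) ∷
  []

stickWord : ∀ {n} → PseudoTiling n → (i j k l : Fin n) →
            i < j → j < k → k < l → Word4
stickWord X i j k l i<j j<k k<l =
  X (triple i j k i<j j<k) ∷
  X (triple i j l i<j (<-trans j<k k<l)) ∷
  X (triple i k l (<-trans i<j j<k) k<l) ∷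
  X (triple j k l j<k k<l) ∷ []

IsTiling : ∀ {n} → PseudoTiling n → Set
IsTiling {n} X = (i j k l : Fin n) (i<j : i < j) (j<k : j < k) (k<l : k < l) →
                 stickWord X i j k l i<j j<k k<l ∈ allowed

IsPartition : ∀ {n m} → (Fin m → PseudoTiling n) → Set
IsPartition {n} {m} T =
  (t : Triple n) → Σ (Fin m) λ s → (T s t ≡ true) × ((s' : Fin m) → T s' t ≡ true → s' ≡ s)

unionOver : ∀ {n m} → (Fin m → PseudoTiling n) → Subset m → PseudoTiling n
unionOver {m = m} T S t = any (λ s → lookup S s ∧ T s t) (allFin m)

-- Every triple t lies in exactly one of the tilings, its owner. Along a stick the owners of the
-- middle triples agree with the owner of the first or of the last triple, since in an
-- admissible word a 1 in the middle forces a 1 at an end; and if the second and fourth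
-- triples have the same owner, so does the third. Hence the word of owners has at most
-- one change (shape xxxy, xxyy or xyyy). The admissible words are exactly the Boolean
-- words of this shape, and membership in T_S is a function of the owner, so T_S inherits it.
module Submission where

open import Defs
open import Data.Nat using (ℕ; _≥_)
open import Data.Fin using (Fin; _<_)
open import Data.Fin.Subset using (Subset)
open import Data.Fin.Properties using (<-trans)
open import Data.Vec using (Vec; []; _∷_; lookup; map)
open import Data.Vec.Properties using (map-cong; map-∘)
open import Data.Bool using (Bool; true; false; _∧_)
open import Data.Bool.Properties using (⇔→≡; ∧-conicalʳ; ∧-identityʳ; T-≡)
open import Data.Bool.ListAction using (any)
open import Data.Product using (_,_; proj₁; proj₂)
open import Data.Sum using (_⊎_; inj₁; inj₂)
open import Data.List using (List)
open import Data.List.Membership.Propositional using (_∈_; lose)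
open import Data.List.Membership.Propositional.Properties using (∈-allFin)
open import Data.List.Relation.Unary.Any using (here; there; satisfied)
open import Data.List.Relation.Unary.Any.Properties using (any⁺; any⁻)
open import Function.Bundles using (mk⇔; Equivalence)
open import Relation.Binary.PropositionalEquality

data TwoBlock {A : Set} : Vec A 4 → Set where
  xxxy : ∀ x y → TwoBlock (x ∷ x ∷ x ∷ y ∷ [])
  xxyy : ∀ x y → TwoBlock (x ∷ x ∷ y ∷ y ∷ [])
  xyyy : ∀ x y → TwoBlock (x ∷ y ∷ y ∷ y ∷ [])

module _ {A : Set} where

  TwoBlock-map : ∀ {B : Set} (f : A → B) {w : Vec A 4} → TwoBlock w → TwoBlock (map f w)
  TwoBlock-map f (xxxy x y) = xxxy (f x) (f y)
  TwoBlock-map f (xxyy x y) = xxyy (f x) (f y)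
  TwoBlock-map f (xyyy x y) = xyyy (f x) (f y)

  TwoBlock-second : ∀ {a b c d : A} → TwoBlock (a ∷ b ∷ c ∷ d ∷ []) → b ≡ a ⊎ b ≡ d
  TwoBlock-second (xxxy x y) = inj₁ refl
  TwoBlock-second (xxyy x y) = inj₁ refl
  TwoBlock-second (xyyy x y) = inj₂ refl

  TwoBlock-third : ∀ {a b c d : A} → TwoBlock (a ∷ b ∷ c ∷ d ∷ []) → c ≡ a ⊎ c ≡ d
  TwoBlock-third (xxxy x y) = inj₁ refl
  TwoBlock-third (xxyy x y) = inj₂ refl
  TwoBlock-third (xyyy x y) = inj₂ refl

  TwoBlock-third≡last : ∀ {a b c d : A} → TwoBlock (a ∷ b ∷ c ∷ d ∷ []) → b ≡ d → c ≡ d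
  TwoBlock-third≡last (xxxy x y) b≡d = b≡d
  TwoBlock-third≡last (xxyy x y) _   = refl
  TwoBlock-third≡last (xyyy x y) _   = refl

  TwoBlock-intro : ∀ {a b c d : A} → b ≡ a ⊎ b ≡ d → c ≡ a ⊎ c ≡ d → (b ≡ d → c ≡ d) →
                   TwoBlock (a ∷ b ∷ c ∷ d ∷ [])
  TwoBlock-intro {a} {d = d} (inj₁ refl) (inj₁ refl) _ = xxxy a d
  TwoBlock-intro {a} {d = d} (inj₁ refl) (inj₂ refl) _ = xxyy a d
  TwoBlock-intro {a} {d = d} (inj₂ refl) _ b≡d→c≡d with b≡d→c≡d refl
  ... | refl = xyyy a d

allowed⇒TwoBlock : ∀ {w : Word4} → w ∈ allowed → TwoBlock w
allowed⇒TwoBlock (here refl)                                                 = xxxy false false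
allowed⇒TwoBlock (there (here refl))                                         = xyyy true false
allowed⇒TwoBlock (there (there (here refl)))                                 = xxyy true false
allowed⇒TwoBlock (there (there (there (here refl))))                         = xxxy true false
allowed⇒TwoBlock (there (there (there (there (here refl)))))                 = xxxy true true
allowed⇒TwoBlock (there (there (there (there (there (here refl))))))         = xyyy false true
allowed⇒TwoBlock (there (there (there (there (there (there (here refl))))))) = xxyy false true
allowed⇒TwoBlock (there (there (there (there (there (there (there (here refl)))))))) = xxxy false true

TwoBlock⇒allowed : ∀ {w : Word4} → TwoBlock w → w ∈ allowed
TwoBlock⇒allowed (xxxy false false) = here refl
TwoBlock⇒allowed (xxxy false true)  = there (there (there (there (there (there (there (here refl)))))))
TwoBlock⇒allowed (xxxy true false)  = there (there (there (here refl)))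
TwoBlock⇒allowed (xxxy true true)   = there (there (there (there (here refl))))
TwoBlock⇒allowed (xxyy false false) = here refl
TwoBlock⇒allowed (xxyy false true)  = there (there (there (there (there (there (here refl))))))
TwoBlock⇒allowed (xxyy true false)  = there (there (here refl))
TwoBlock⇒allowed (xxyy true true)   = there (there (there (there (here refl))))
TwoBlock⇒allowed (xyyy false false) = here refl
TwoBlock⇒allowed (xyyy false true)  = there (there (there (there (there (here refl)))))
TwoBlock⇒allowed (xyyy true false)  = there (here refl)
TwoBlock⇒allowed (xyyy true true)   = there (there (there (there (here refl))))

any-unique : ∀ {A : Set} (p : A → Bool) {x : A} {xs : List A} → x ∈ xs →
             (∀ {y} → p y ≡ true → y ≡ x) → any p xs ≡ p x
any-unique p {x} {xs} x∈xs unique = ⇔→≡ (mk⇔ to from)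
  where
  to : any p xs ≡ true → p x ≡ true
  to any≡true with satisfied (any⁻ p xs (Equivalence.from T-≡ any≡true))
  ... | y , py = subst (λ z → p z ≡ true) (unique py′) py′
    where py′ = Equivalence.to T-≡ py
  from : p x ≡ true → any p xs ≡ true
  from px = Equivalence.to T-≡ (any⁺ p (lose x∈xs (Equivalence.from T-≡ px)))

-- stickWord X i j k l … is definitionally map X (stick i j k l …).
stick : ∀ {n} (i j k l : Fin n) → i < j → j < k → k < l → Vec (Triple n) 4
stick i j k l i<j j<k k<l =
  triple i j k i<j j<k ∷
  triple i j l i<j (<-trans j<k k<l) ∷
  triple i k l (<-trans i<j j<k) k<l ∷
  triple j k l j<k k<l ∷ []

module Partition {n m : ℕ} (T : Fin m → PseudoTiling n) (partition : IsPartition T) where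

  owner : Triple n → Fin m
  owner t = proj₁ (partition t)

  owner-∋ : ∀ t → T (owner t) t ≡ true
  owner-∋ t = proj₁ (proj₂ (partition t))

  owner-unique : ∀ {s} t → T s t ≡ true → s ≡ owner t
  owner-unique t = proj₂ (proj₂ (partition t)) _

  unionOver-owner : ∀ S t → unionOver T S t ≡ lookup S (owner t)
  unionOver-owner S t = begin
    unionOver T S t                        ≡⟨ any-unique (λ s → lookup S s ∧ T s t) (∈-allFin (owner t))
                                                (λ {s} ∈S∧T → owner-unique t (∧-conicalʳ (lookup S s) _ ∈S∧T)) ⟩
    lookup S (owner t) ∧ T (owner t) t     ≡⟨ cong (lookup S (owner t) ∧_) (owner-∋ t) ⟩
    lookup S (owner t) ∧ true              ≡⟨ ∧-identityʳ _ ⟩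
    lookup S (owner t)                     ∎
    where open ≡-Reasoning

  owners-TwoBlock : ((s : Fin m) → IsTiling (T s)) →
                    ∀ i j k l (i<j : i < j) (j<k : j < k) (k<l : k < l) →
                    TwoBlock (map owner (stick i j k l i<j j<k k<l))
  owners-TwoBlock tiling i j k l i<j j<k k<l =
    TwoBlock-intro (owner-at-end t₂ (TwoBlock-second (word t₂)))
                   (owner-at-end t₃ (TwoBlock-third (word t₃)))
                   shared-owner
    where
    t₁ t₂ t₃ t₄ : Triple n
    t₁ = triple i j k i<j j<k
    t₂ = triple i j l i<j (<-trans j<k k<l)
    t₃ = triple i k l (<-trans i<j j<k) k<l
    t₄ = triple j k l j<k k<l

    word : ∀ t → TwoBlock (map (T (owner t)) (stick i j k l i<j j<k k<l))
    word t = allowed⇒TwoBlock (tiling (owner t) i j k l i<j j<k k<l)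

    shared-owner : owner t₂ ≡ owner t₄ → owner t₃ ≡ owner t₄
    shared-owner o₂≡o₄ = sym (owner-unique t₃ (trans t₃≡t₄ (owner-∋ t₄)))
      where
      t₂∈T₄ : T (owner t₄) t₂ ≡ true
      t₂∈T₄ = subst (λ s → T s t₂ ≡ true) o₂≡o₄ (owner-∋ t₂)
      t₃≡t₄ : T (owner t₄) t₃ ≡ T (owner t₄) t₄
      t₃≡t₄ = TwoBlock-third≡last (word t₄) (trans t₂∈T₄ (sym (owner-∋ t₄)))

    owner-at-end : ∀ t → T (owner t) t ≡ T (owner t) t₁ ⊎ T (owner t) t ≡ T (owner t) t₄ →
                   owner t ≡ owner t₁ ⊎ owner t ≡ owner t₄
    owner-at-end t (inj₁ e) = inj₁ (owner-unique t₁ (trans (sym e) (owner-∋ t)))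
    owner-at-end t (inj₂ e) = inj₂ (owner-unique t₄ (trans (sym e) (owner-∋ t)))

lemma2 : (n m : ℕ) → n ≥ 2 → (T : Fin m → PseudoTiling n) →
    ((s : Fin m) → IsTiling (T s)) → IsPartition T →
    (S : Subset m) → IsTiling (unionOver T S)
lemma2 n m _ T tiling partition S i j k l i<j j<k k<l =
  subst (_∈ allowed) (sym unionWord≡) (TwoBlock⇒allowed (TwoBlock-map (lookup S) owners))
  where
  open Partition T partition
  sticks = stick i j k l i<j j<k k<l
  owners = owners-TwoBlock tiling i j k l i<j j<k k<l
  unionWord≡ : map (unionOver T S) sticks ≡ map (lookup S) (map owner sticks)
  unionWord≡ = trans (map-cong (unionOver-owner S) sticks) (map-∘ (lookup S) owner sticks)
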